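{- Let $\vec\alpha\,F$ be an $n$-ary bounded natural functor (BNF). Then for all sets $A_1,\dots,A_n$ (with $A_i$ a set of elements of type $\alpha_i$), $$F_{\mathrm{in}}\,\vec A=\{x\mid \forall \vec f\,\vec g.\ (\forall i.\ \forall a\in A_i.\ f_i\,a=g_i\,a)\longrightarrow \mathrm{map}_F\,\vec f\,x=\mathrm{map}_F\,\vec g\,x\},$$ where $f_i,g_i$ range over functions of type $\alpha_i\to \mathsf 1+\alpha_i$.
   Context: We work in higher-order logic (Isabelle/HOL), in which every type is non-empty. Vector notation $\vec x$ abbreviates $x_1,\dots,x_n$, with synchronized indices (e.g. $\mathrm{map}_F\,\overrightarrow{(g\circ f)}$ means $\mathrm{map}_F\,(g_1\circ f_1)\dots(g_n\circ f_n)$). Relations are identified with sets of pairs; $f\langle X\rangle$ is the image of $X$ under $f$. An $n$-ary BNF is a type constructor $\vec\alpha\,F$ with polymorphic operations $\mathrm{map}_F::(\alpha_1\to\beta_1)\to\cdots\to(\alpha_n\to\beta_n)\to\vec\alpha\,F\to\vec\beta\,F$, setters $\mathrm{set}_{F,i}::\vec\alpha\,F\to\alpha_i\ \mathrm{set}$ ($i=1,\dots,n$), an infinite cardinal bound $\mathrm{bd}_F$ and a relator $\mathrm{rel}_F$, satisfying: $\mathrm{map}_F\,\vec{\mathrm{id}}=\mathrm{id}$; $\mathrm{map}_F\,\vec g\circ\mathrm{map}_F\,\vec f=\mathrm{map}_F\,\overrightarrow{(g\circ f)}$; $\mathrm{set}_{F,i}(\mathrm{map}_F\,\vec f\,x)=f_i\langle\mathrm{set}_{F,i}\,x\rangle$;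 if $f_i\,z=g_i\,z$ for all $i$ and all $z\in\mathrm{set}_{F,i}\,x$ then $\mathrm{map}_F\,\vec f\,x=\mathrm{map}_F\,\vec g\,x$; $|\mathrm{set}_{F,i}\,x|\le\mathrm{bd}_F$; $(x,y)\in\mathrm{rel}_F\,\vec R$ iff there is $z$ with $\mathrm{set}_{F,i}\,z\subseteq R_i$ for all $i$, $\mathrm{map}_F\,\overrightarrow{\mathrm{fst}}\,z=x$ and $\mathrm{map}_F\,\overrightarrow{\mathrm{snd}}\,z=y$; and $\mathrm{rel}_F\,\vec R\bullet\mathrm{rel}_F\,\vec S\subseteq\mathrm{rel}_F\,\overrightarrow{(R\bullet S)}$, where $\bullet$ is relation composition. Define $F_{\mathrm{in}}\,\vec A=\{x\mid\forall i.\ \mathrm{set}_{F,i}\,x\subseteq A_i\}$. The type $\mathsf 1+\alpha$ is the sum of the unit type and $\alpha$. -}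

module Defs where

open import Data.Nat using (ℕ)
open import Data.Fin using (Fin)
open import Data.Bool using (Bool; true)
open import Data.Product using (Σ; ∃; _×_; proj₁; proj₂)
open import Function.Bundles using (_↣_; _⇔_)
open import Relation.Binary.PropositionalEquality using (_≡_)

-- HOL sets: a set of elements of type α is a predicate α → Bool
-- (this is literally HOL's 'α set').  Membership: a ∈ₛ X  ⇔  X a ≡ true.
HSet : Set → Set
HSet α = α → Bool

_∈ₛ_ : {α : Set} → α → HSet α → Set
a ∈ₛ X = X a ≡ true

TyVec : ℕ → Set₁
TyVec n = Fin n → Set

record BNF (n : ℕ) : Set₁ where
  field
    F    : TyVec n → Set
    map  : {α β : TyVec n} → ((i : Fin n) → α i → β i) → F α → F β
    set  : {α : TyVec n} → (i : Fin n) → F α → HSet (α i)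
    bd   : Set          -- the cardinal bound, represented by a type of that cardinality
    rel  : {α β : TyVec n} → ((i : Fin n) → α i → β i → Bool) → F α → F β → Bool

    map-id   : {α : TyVec n} (x : F α) → map (λ i a → a) x ≡ x
    map-comp : {α β γ : TyVec n} (g : (i : Fin n) → β i → γ i) (f : (i : Fin n) → α i → β i)
               (x : F α) → map g (map f x) ≡ map (λ i a → g i (f i a)) x
    set-map  : {α β : TyVec n} (f : (i : Fin n) → α i → β i) (x : F α) (i : Fin n) (b : β i) →
               (b ∈ₛ set i (map f x)) ⇔ (∃ λ a → (a ∈ₛ set i x) × (f i a ≡ b))
    map-cong : {α β : TyVec n} (f g : (i : Fin n) → α i → β i) (x : F α) →
               ((i : Fin n) (z : α i) → z ∈ₛ set i x → f i z ≡ g i z) → map f x ≡ map g x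
    bd-infinite : ℕ ↣ bd
    set-bd   : {α : TyVec n} (i : Fin n) (x : F α) → (Σ (α i) (λ a → a ∈ₛ set i x)) ↣ bd
    in-rel   : {α β : TyVec n} (R : (i : Fin n) → α i → β i → Bool) (x : F α) (y : F β) →
               (rel R x y ≡ true) ⇔
               (∃ λ (z : F (λ i → α i × β i)) →
                  ((i : Fin n) (p : α i × β i) → p ∈ₛ set i z → R i (proj₁ p) (proj₂ p) ≡ true)
                  × map (λ i → proj₁) z ≡ x × map (λ i → proj₂) z ≡ y)
    rel-comp : {α β γ : TyVec n} (R : (i : Fin n) → α i → β i → Bool)
               (S : (i : Fin n) → β i → γ i → Bool) (T : (i : Fin n) → α i → γ i → Bool) →
               ((i : Fin n) (a : α i) (c : γ i) → (T i a c ≡ true) ⇔ (∃ λ b → (R i a b ≡ true) × (S i b c ≡ true))) →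
               (x : F α) (y : F β) (z : F γ) →
               rel R x y ≡ true → rel S y z ≡ true → rel T x z ≡ true

F-in : {n : ℕ} (B : BNF n) {α : TyVec n} → ((i : Fin n) → HSet (α i)) → BNF.F B α → Set
F-in B A x = (i : Fin _) (a : _) → a ∈ₛ BNF.set B i x → a ∈ₛ A i

{-# OPTIONS --safe #-}
-- If every setᵢ x lies in Aᵢ, maps agreeing on A agree on the sets of x, so congruence
-- applies.  Conversely, the embedding inj₂ and the map sending everything outside Aᵢ to
-- the unit agree on A, hence have the same image of x; by naturality of the setters an
-- element a of setᵢ x then shows up as inj₂ a in the setter of the second image, which
-- is only possible for a ∈ Aᵢ.
module Submission where

open import Defs
open import Data.Nat using (ℕ)
open import Data.Fin using (Fin)
open import Data.Unit using (⊤; tt)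
open import Data.Bool using (Bool; true; false)
open import Data.Sum using (_⊎_; inj₁; inj₂)
open import Data.Product using (_,_)
open import Function.Bundles using (_⇔_; mk⇔; Equivalence)
open import Relation.Binary.PropositionalEquality using (_≡_; refl; subst)

restrictBy : {α : Set} → Bool → α → ⊤ ⊎ α
restrictBy true  a = inj₂ a
restrictBy false a = inj₁ tt

restrict : {α : Set} → HSet α → α → ⊤ ⊎ α
restrict X a = restrictBy (X a) a

inj₂≡restrict : {α : Set} (X : HSet α) {a : α} → a ∈ₛ X → inj₂ a ≡ restrict X a
inj₂≡restrict X {a} a∈X rewrite a∈X = refl

restrict≡inj₂⇒∈ : {α : Set} (X : HSet α) {a b : α} → restrict X a ≡ inj₂ b → b ∈ₛ X
restrict≡inj₂⇒∈ X {a} eq with X a in a∈X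
restrict≡inj₂⇒∈ X {a} refl | true = a∈X

module _ {n : ℕ} (B : BNF n) where
  open BNF B

  map-cong-F-in : {α β : TyVec n} (A : (i : Fin n) → HSet (α i)) {x : F α} → F-in B A x →
                  (f g : (i : Fin n) → α i → β i) →
                  ((i : Fin n) (a : α i) → a ∈ₛ A i → f i a ≡ g i a) → map f x ≡ map g x
  map-cong-F-in A {x} x∈A f g f≈g = map-cong f g x (λ i a a∈x → f≈g i a (x∈A i a a∈x))

  image-∈-set-map : {α β : TyVec n} (f : (i : Fin n) → α i → β i) {x : F α} {i : Fin n} {a : α i} →
                    a ∈ₛ set i x → f i a ∈ₛ set i (map f x)
  image-∈-set-map f {x} {i} {a} a∈x = Equivalence.from (set-map f x i (f i a)) (a , a∈x , refl)

  map-inj₂≡map-restrict⇒F-in : {α : TyVec n} (A : (i : Fin n) → HSet (α i)) (x : F α) →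
                               map (λ i → inj₂) x ≡ map (λ i → restrict (A i)) x → F-in B A x
  map-inj₂≡map-restrict⇒F-in A x same i a a∈x
    with Equivalence.to (set-map (λ j → restrict (A j)) x i (inj₂ a)) inj₂a∈
    where
    inj₂a∈ : inj₂ a ∈ₛ set i (map (λ j → restrict (A j)) x)
    inj₂a∈ = subst (λ y → inj₂ a ∈ₛ set i y) same (image-∈-set-map (λ j → inj₂) a∈x)
  ... | _ , _ , restrict≡inj₂a = restrict≡inj₂⇒∈ (A i) restrict≡inj₂a

mainTheorem1 : {n : ℕ} (B : BNF n) {α : TyVec n} (A : (i : Fin n) → HSet (α i)) (x : BNF.F B α) →
    F-in B A x ⇔
      ((f g : (i : Fin n) → α i → ⊤ ⊎ α i) →
        ((i : Fin n) (a : α i) → a ∈ₛ A i → f i a ≡ g i a) →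
        BNF.map B f x ≡ BNF.map B g x)
mainTheorem1 B A x = mk⇔
  (map-cong-F-in B A)
  (λ agree → map-inj₂≡map-restrict⇒F-in B A x
    (agree (λ i → inj₂) (λ i → restrict (A i)) (λ i a → inj₂≡restrict (A i))))
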